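{- Let $\mathcal{O}$ be a Dedekind domain, $I\subset\mathcal{O}$ an ideal, and $n\ge 3$. Let $\sigma$ be an $(n-2)$-simplex of $\mathcal{B}_n(I)$, and let $v$ be a vertex of $\sigma$ with $L(v)\neq 0$. If $I_\sigma\not\subset I$, assume additionally that $L(v)\equiv 1\pmod I$. Then there exists a vertex $w$ of $\mathrm{Link}_{\mathcal{B}_n(I)}(\sigma)$ such that $I_{\{v,w\}}=\mathcal{O}$.
   Context: Fix a surjection $L\colon\mathcal{O}^n\to\mathcal{O}$. A basis $\{v_1,\dots,v_n\}$ of $\mathcal{O}^n$ is an $I$-basis if $L(v_i)\equiv0$ or $1\pmod I$ for all $i$; $\mathcal{B}_n(I)$ is the simplicial complex whose simplices are subsets of $I$-bases. For a partial basis $\tau=\{u_1,\dots,u_k\}$ of $\mathcal{O}^n$ (a subset of some basis), $V_\tau$ is the direct summand of $\mathcal{O}^n$ spanned by $u_1,\dots,u_k$ and $I_\tau=L(V_\tau)\subset\mathcal{O}$ (the ideal generated by $L(u_1),\dots,L(u_k)$). -}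

module Defs where

open import Level using (Level; _⊔_; suc)
open import Algebra.Bundles using (CommutativeRing)
open import Data.Nat as ℕ using (ℕ; zero; _∸_)
open import Data.Fin using (Fin; toℕ)
import Data.Fin as Fin
open import Data.Product using (Σ; ∃; _×_; _,_)
open import Data.Sum using (_⊎_)
open import Relation.Nullary using (¬_)
open import Relation.Binary.PropositionalEquality using () renaming (_≡_ to _≡ᶠ_)

module Theory {c ℓ : Level} (R : CommutativeRing c ℓ) where
  open CommutativeRing R

  sumFin : (k : ℕ) → (Fin k → Carrier) → Carrier
  sumFin zero    f = 0#
  sumFin (ℕ.suc k) f = f Fin.zero + sumFin k (λ i → f (Fin.suc i))

  pow : Carrier → ℕ → Carrier
  pow x zero      = 1#
  pow x (ℕ.suc d) = x * pow x d

  _-ᵣ_ : Carrier → Carrier → Carrier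
  x -ᵣ y = x + (- y)

  Pred : Set (suc (c ⊔ ℓ))
  Pred = Carrier → Set (c ⊔ ℓ)

  _⊆_ : Pred → Pred → Set (c ⊔ ℓ)
  P ⊆ Q = ∀ x → P x → Q x

  record IsIdeal (I : Pred) : Set (c ⊔ ℓ) where
    field
      resp  : ∀ {x y} → x ≈ y → I x → I y
      zero∈ : I 0#
      +∈    : ∀ {x y} → I x → I y → I (x + y)
      *∈    : ∀ r {x} → I x → I (r * x)

  Span : (k : ℕ) → (Fin k → Carrier) → Pred
  Span k g x = Σ (Fin k → Carrier) λ a → x ≈ sumFin k (λ i → a i * g i)

  _≡_mod_ : Carrier → Carrier → Pred → Set (c ⊔ ℓ)
  x ≡ y mod I = I (x -ᵣ y)

  IsIntegralDomain : Set (c ⊔ ℓ)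
  IsIntegralDomain = (¬ (1# ≈ 0#)) × (∀ x y → x * y ≈ 0# → x ≈ 0# ⊎ y ≈ 0#)

  IsNoetherian : Set (suc (c ⊔ ℓ))
  IsNoetherian = ∀ (I : Pred) → IsIdeal I →
    Σ ℕ λ k → Σ (Fin k → Carrier) λ g → (∀ i → I (g i)) × (I ⊆ Span k g)

  -- a/b (b ≠ 0) integral over O, i.e. a root of a monic polynomial
  --   X^d + c_{d-1} X^{d-1} + … + c₀, cleared of denominators:
  --   a^d + Σ_{i<d} c_i a^i b^{d-i} = 0,  implies  a/b ∈ O, i.e. b ∣ a.
  IsIntegrallyClosed : Set (c ⊔ ℓ)
  IsIntegrallyClosed = ∀ (a b : Carrier) → ¬ (b ≈ 0#) →
    ∀ (d : ℕ) (cf : Fin d → Carrier) →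
    pow a d + sumFin d (λ i → cf i * (pow a (toℕ i) * pow b (d ∸ toℕ i))) ≈ 0# →
    Σ Carrier λ q → a ≈ q * b

  record IsPrimeIdeal (P : Pred) : Set (c ⊔ ℓ) where
    field
      ideal  : IsIdeal P
      proper : ¬ P 1#
      prime  : ∀ x y → P (x * y) → P x ⊎ P y

  IsMaximalAbove : Pred → Set (suc (c ⊔ ℓ))
  IsMaximalAbove P = ∀ (J : Pred) → IsIdeal J → P ⊆ J → (J ⊆ P) ⊎ J 1#

  DimAtMostOne : Set (suc (c ⊔ ℓ))
  DimAtMostOne = ∀ (P : Pred) → IsPrimeIdeal P →
    (Σ Carrier λ x → P x × ¬ (x ≈ 0#)) → IsMaximalAbove P

  record IsDedekindDomain : Set (suc (c ⊔ ℓ)) where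
    field
      domain           : IsIntegralDomain
      noetherian       : IsNoetherian
      integrallyClosed : IsIntegrallyClosed
      dimLeOne         : DimAtMostOne

  Vecᴼ : ℕ → Set c
  Vecᴼ n = Fin n → Carrier

  _≈ᵛ_ : ∀ {n} → Vecᴼ n → Vecᴼ n → Set ℓ
  u ≈ᵛ v = ∀ j → u j ≈ v j

  lincomb : ∀ {n} (k : ℕ) → (Fin k → Carrier) → (Fin k → Vecᴼ n) → Vecᴼ n
  lincomb k a b j = sumFin k (λ i → a i * b i j)

  _+ᵛ_ : ∀ {n} → Vecᴼ n → Vecᴼ n → Vecᴼ n
  (u +ᵛ v) j = u j + v j

  _·ᵛ_ : ∀ {n} → Carrier → Vecᴼ n → Vecᴼ n
  (r ·ᵛ v) j = r * v j

  record IsLinearSurjection {n : ℕ} (L : Vecᴼ n → Carrier) : Set (c ⊔ ℓ) where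
    field
      resp       : ∀ {u v} → u ≈ᵛ v → L u ≈ L v
      additive   : ∀ u v → L (u +ᵛ v) ≈ L u + L v
      homogen    : ∀ r v → L (r ·ᵛ v) ≈ r * L v
      surjective : ∀ r → Σ (Vecᴼ n) λ v → L v ≈ r

  record IsBasis {n : ℕ} (b : Fin n → Vecᴼ n) : Set (c ⊔ ℓ) where
    field
      spans       : ∀ (x : Vecᴼ n) → Σ (Fin n → Carrier) λ a → x ≈ᵛ lincomb n a b
      independent : ∀ (a : Fin n → Carrier) → lincomb n a b ≈ᵛ (λ _ → 0#) → ∀ i → a i ≈ 0#

  IsIBasis : ∀ {n} → (Vecᴼ n → Carrier) → Pred → (Fin n → Vecᴼ n) → Set (c ⊔ ℓ)
  IsIBasis L I b = IsBasis b × (∀ i → (L (b i) ≡ 0# mod I) ⊎ (L (b i) ≡ 1# mod I))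

  _∈ᶠ_ : ∀ {n k} → Vecᴼ n → (Fin k → Vecᴼ n) → Set ℓ
  v ∈ᶠ b = Σ _ λ i → v ≈ᵛ b i

  Distinct : ∀ {n k} → (Fin k → Vecᴼ n) → Set ℓ
  Distinct {k = k} s = ∀ (i j : Fin k) → s i ≈ᵛ s j → i ≡ᶠ j

  InSomeIBasis : ∀ {n k} → (Vecᴼ n → Carrier) → Pred → (Fin k → Vecᴼ n) → Set (c ⊔ ℓ)
  InSomeIBasis {n} L I s =
    Σ (Fin n → Vecᴼ n) λ b → IsIBasis L I b × (∀ i → s i ∈ᶠ b)

  _◂_ : ∀ {n k} → Vecᴼ n → (Fin k → Vecᴼ n) → (Fin (ℕ.suc k) → Vecᴼ n)
  (w ◂ s) Fin.zero    = w
  (w ◂ s) (Fin.suc i) = s i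

  -- w is a vertex of Link_{B_n(I)}(σ): w ∉ σ and σ ∪ {w} is a simplex of B_n(I)
  InLink : ∀ {n k} → (Vecᴼ n → Carrier) → Pred → (Fin k → Vecᴼ n) → Vecᴼ n → Set (c ⊔ ℓ)
  InLink L I s w = (¬ (w ∈ᶠ s)) × InSomeIBasis L I (w ◂ s)

  Iτ : ∀ {n k} → (Vecᴼ n → Carrier) → (Fin k → Vecᴼ n) → Pred
  Iτ {k = k} L s = Span k (λ i → L (s i))

  pair : ∀ {n} → Vecᴼ n → Vecᴼ n → (Fin 2 → Vecᴼ n)
  pair v w Fin.zero       = v
  pair v w (Fin.suc _)    = w

{-# OPTIONS --safe #-}
-- Extend σ to an I-basis b. As σ has n - 1 elements it misses exactly one basis vector b_k, and
-- writing a preimage of 1 under L as r b_k + y with y in the span of σ shows that (L b_k, L y)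
-- is unimodular with L y ∈ I_σ. A Noetherian domain of dimension at most one has stable range
-- one modulo the nonzero element L v, so some c makes L b_k + c L y a unit modulo L v. The
-- transvection b_k ↦ w = b_k + c y - μ v keeps an I-basis containing σ, and (L v, L w) stays
-- unimodular for every μ: μ = 0 gives L w ≡ L b_k (mod I) when I_σ ⊆ I, and
-- μ = L b_k + c L y gives L w ≡ 0 (mod I) when L v ≡ 1.
module Submission where

open import Defs
open import Level using (Level; _⊔_; Lift; lift)
open import Algebra.Bundles using (CommutativeRing)
open import Axiom.ExcludedMiddle using (ExcludedMiddle)
open import Data.Nat as ℕ using (ℕ; zero; suc; _≤_; _∸_; _≤′_; ≤′-refl; ≤′-step)
  renaming (_⊔_ to _⊔ℕ_)
open import Data.Nat.Properties using (1+n≰n; ≤⇒≤′; m≤m⊔n; m≤n⊔m)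
open import Data.Fin using (Fin; zero; suc; punchOut)
open import Data.Fin.Properties using (any?; all?; _≟_; punchOut-injective; injective⇒≤)
open import Data.Vec.Functional using (_∷_; [])
open import Data.Empty using (⊥-elim)
open import Data.Product using (Σ; ∃; _×_; _,_; proj₁; proj₂)
open import Data.Sum as Sum using (_⊎_; inj₁; inj₂; [_,_]′)
open import Function.Base using (_∘_; id; case_of_)
open import Function.Definitions using (Injective)
open import Relation.Nullary using (¬_; Dec; yes; no; ¬?; contradiction)
open import Relation.Binary.PropositionalEquality as ≡ using (_≡_; _≢_)

injective⇒surjective : ∀ {m} (g : Fin m → Fin m) → Injective _≡_ _≡_ g → ∀ j → ∃ λ i → g i ≡ j
injective⇒surjective {suc m} g g-injective j with any? (λ i → g i ≟ j)
... | yes hit = hit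
... | no  miss = contradiction (injective⇒≤ punched-injective) 1+n≰n
  where
  j≢g : ∀ i → j ≢ g i
  j≢g i j≡gᵢ = miss (i , ≡.sym j≡gᵢ)
  punched : Fin (suc m) → Fin m
  punched i = punchOut (j≢g i)
  punched-injective : Injective _≡_ _≡_ punched
  punched-injective {i} {i′} e = g-injective (punchOut-injective (j≢g i) (j≢g i′) e)

injective⇒misses : ∀ {m} (f : Fin m → Fin (suc m)) → Injective _≡_ _≡_ f → ∃ λ k → ∀ i → f i ≢ k
injective⇒misses {m} f f-injective with any? (λ k → all? (λ i → ¬? (f i ≟ k)))
... | yes missed = missed
... | no  none   = contradiction (injective⇒≤ preimage-injective) 1+n≰n
  where
  hit : ∀ k → ∃ λ i → f i ≡ k
  hit k with any? (λ i → f i ≟ k)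
  ... | yes found    = found
  ... | no  notFound = contradiction (k , λ i e → notFound (i , e)) none
  preimage-injective : Injective _≡_ _≡_ (proj₁ ∘ hit)
  preimage-injective {k} {k′} e = ≡.trans (≡.sym (proj₂ (hit k))) (≡.trans (≡.cong f e) (proj₂ (hit k′)))

injective-missing⇒hits : ∀ {m} (f : Fin m → Fin (suc m)) → Injective _≡_ _≡_ f →
                         ∀ {k} → (∀ i → f i ≢ k) → ∀ j → j ≢ k → ∃ λ i → f i ≡ j
injective-missing⇒hits {m} f f-injective {k} f≢k j j≢k =
  let i , e = injective⇒surjective punched punched-injective (punchOut (j≢k ∘ ≡.sym))
  in i , punchOut-injective (f≢k i ∘ ≡.sym) (j≢k ∘ ≡.sym) e
  where
  punched : Fin m → Fin m
  punched i = punchOut (f≢k i ∘ ≡.sym)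
  punched-injective : Injective _≡_ _≡_ punched
  punched-injective {i} {i′} e = f-injective (punchOut-injective (f≢k i ∘ ≡.sym) (f≢k i′ ∘ ≡.sym) e)

module CommutativeAlgebra {c ℓ : Level} (R : CommutativeRing c ℓ) where
  open CommutativeRing R hiding (zero)
  open Theory R
  open import Algebra.Properties.Ring ring using (-1*x≈-x; -‿distribʳ-*)
  open import Algebra.Properties.AbelianGroup +-abelianGroup
    using (//-rightDividesˡ; //-rightDividesʳ; xyx⁻¹≈y; ε⁻¹≈ε; ⁻¹-involutive)
  open import Algebra.Properties.Semiring.Exp semiring using (_^_; ^-homo-*)
  open import Algebra.Properties.Semiring.Sum semiring
    using (sum; sum-cong-≋; sum-replicate-zero; ∑-distrib-+; *-distribˡ-sum)
  open import Algebra.Solver.Ring.NaturalCoefficients.Default commutativeSemiring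
  open import Data.Vec.Functional.Relation.Binary.Equality.Setoid setoid
    using (≋-refl; ≋-reflexive; ≋-sym; ≋-trans)
  open import Relation.Binary.Reasoning.Setoid setoid

  sumFin≈sum : ∀ k (f : Fin k → Carrier) → sumFin k f ≈ sum f
  sumFin≈sum zero    f = refl
  sumFin≈sum (suc k) f = +-congˡ (sumFin≈sum k (f ∘ suc))

  sumFin-cong : ∀ k {f g : Fin k → Carrier} → (∀ i → f i ≈ g i) → sumFin k f ≈ sumFin k g
  sumFin-cong k {f} {g} f≈g = trans (sumFin≈sum k f) (trans (sum-cong-≋ f≈g) (sym (sumFin≈sum k g)))

  sumFin-zero : ∀ k {f : Fin k → Carrier} → (∀ i → f i ≈ 0#) → sumFin k f ≈ 0#
  sumFin-zero k f≈0 = trans (sumFin-cong k f≈0) (trans (sumFin≈sum k _) (sum-replicate-zero k))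

  sumFin-+ : ∀ k (f g : Fin k → Carrier) → sumFin k (λ i → f i + g i) ≈ sumFin k f + sumFin k g
  sumFin-+ k f g =
    trans (sumFin≈sum k _) (trans (∑-distrib-+ f g) (sym (+-cong (sumFin≈sum k f) (sumFin≈sum k g))))

  *-distribˡ-sumFin : ∀ k x (f : Fin k → Carrier) → x * sumFin k f ≈ sumFin k (λ i → x * f i)
  *-distribˡ-sumFin k x f =
    trans (*-congˡ (sumFin≈sum k f)) (trans (*-distribˡ-sum x f) (sym (sumFin≈sum k _)))

  δ : ∀ {n} → Fin n → Fin n → Carrier
  δ zero    zero    = 1#
  δ zero    (suc _) = 0#
  δ (suc _) zero    = 0#
  δ (suc i) (suc j) = δ i j

  δ-diag : ∀ {n} (i : Fin n) → δ i i ≈ 1#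
  δ-diag zero    = refl
  δ-diag (suc i) = δ-diag i

  δ-offdiag : ∀ {n} {i j : Fin n} → i ≢ j → δ i j ≈ 0#
  δ-offdiag {i = zero}  {zero}  i≢j = contradiction ≡.refl i≢j
  δ-offdiag {i = zero}  {suc j} i≢j = refl
  δ-offdiag {i = suc i} {zero}  i≢j = refl
  δ-offdiag {i = suc i} {suc j} i≢j = δ-offdiag (i≢j ∘ ≡.cong suc)

  sumFin-δ : ∀ k (j : Fin k) (f : Fin k → Carrier) → sumFin k (λ i → δ j i * f i) ≈ f j
  sumFin-δ (suc k) zero f = begin
    1# * f zero + sumFin k (λ i → 0# * f (suc i))
      ≈⟨ +-cong (*-identityˡ _) (sumFin-zero k (λ i → zeroˡ _)) ⟩
    f zero + 0#
      ≈⟨ +-identityʳ _ ⟩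
    f zero ∎
  sumFin-δ (suc k) (suc j) f = begin
    0# * f zero + sumFin k (λ i → δ j i * f (suc i))
      ≈⟨ +-cong (zeroˡ _) (sumFin-δ k j (f ∘ suc)) ⟩
    0# + f (suc j)
      ≈⟨ +-identityˡ _ ⟩
    f (suc j) ∎

  module _ {J : Pred} (J-ideal : IsIdeal J) where
    open IsIdeal J-ideal

    ideal-neg : ∀ {x} → J x → J (- x)
    ideal-neg x∈ = resp (-1*x≈-x _) (*∈ (- 1#) x∈)

    ideal-sumFin : ∀ k {f : Fin k → Carrier} → (∀ i → J (f i)) → J (sumFin k f)
    ideal-sumFin zero    f∈ = zero∈
    ideal-sumFin (suc k) f∈ = +∈ (f∈ zero) (ideal-sumFin k (f∈ ∘ suc))

    Span-least : ∀ k {g : Fin k → Carrier} → (∀ i → J (g i)) → Span k g ⊆ J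
    Span-least k g∈ x (a , x≈) = resp (sym x≈) (ideal-sumFin k (λ i → *∈ (a i) (g∈ i)))

    ideal-pow : ∀ {x} n → J x → J (pow x (suc n))
    ideal-pow n x∈ = resp (*-comm _ _) (*∈ _ x∈)

    ideal-1-pow : ∀ {x} → J (1# - x) → ∀ n → J (1# - pow x n)
    ideal-1-pow     1-x∈ zero    = resp (sym (-‿inverseʳ 1#)) zero∈
    ideal-1-pow {x} 1-x∈ (suc n) = resp telescope (+∈ (ideal-1-pow 1-x∈ n) (*∈ (pow x n) 1-x∈))
      where
      telescope : (1# - pow x n) + pow x n * (1# - x) ≈ 1# - pow x (suc n)
      telescope = begin
        (1# - pow x n) + pow x n * (1# - x)
          ≈⟨ +-congˡ (trans (distribˡ _ _ _) (+-cong (*-identityʳ _) (sym (-‿distribʳ-* _ _)))) ⟩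
        (1# - pow x n) + (pow x n - pow x n * x)
          ≈⟨ solve 4 (λ o m p q → (o :+ m) :+ (p :+ q) := (o :+ q) :+ (p :+ m))
                     refl 1# (- pow x n) (pow x n) (- (pow x n * x)) ⟩
        (1# - pow x n * x) + (pow x n - pow x n)
          ≈⟨ +-cong (+-congˡ (-‿cong (*-comm _ _))) (-‿inverseʳ _) ⟩
        (1# - pow x (suc n)) + 0#
          ≈⟨ +-identityʳ _ ⟩
        1# - pow x (suc n) ∎

  prime-pow : ∀ {P} → IsPrimeIdeal P → ∀ {x} n → P (pow x n) → P x
  prime-pow P-prime zero    1∈P   = contradiction 1∈P (IsPrimeIdeal.proper P-prime)
  prime-pow P-prime (suc n) xxⁿ∈P with IsPrimeIdeal.prime P-prime _ _ xxⁿ∈P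
  ... | inj₁ x∈P  = x∈P
  ... | inj₂ xⁿ∈P = prime-pow P-prime n xⁿ∈P

  Span-isIdeal : ∀ k (g : Fin k → Carrier) → IsIdeal (Span k g)
  Span-isIdeal k g = record
    { resp  = λ x≈y (a , x≈) → a , trans (sym x≈y) x≈
    ; zero∈ = (λ _ → 0#) , sym (sumFin-zero k (λ i → zeroˡ (g i)))
    ; +∈    = λ (a , x≈) (b , y≈) → (λ i → a i + b i) , trans (+-cong x≈ y≈)
                (trans (sym (sumFin-+ k _ _)) (sumFin-cong k (λ i → sym (distribʳ (g i) (a i) (b i)))))
    ; *∈    = λ r (a , x≈) → (λ i → r * a i) , trans (*-congˡ x≈)
                (trans (*-distribˡ-sumFin k r _) (sumFin-cong k (λ i → sym (*-assoc r (a i) (g i)))))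
    }

  Span-∋ : ∀ k (g : Fin k → Carrier) i → Span k g (g i)
  Span-∋ k g i = δ i , sym (sumFin-δ k i g)

  Gens : Set c
  Gens = Σ ℕ λ k → Fin k → Carrier

  ⟨_⟩ : Gens → Pred
  ⟨ k , g ⟩ = Span k g

  ⟨⟩-isIdeal : ∀ s → IsIdeal ⟨ s ⟩
  ⟨⟩-isIdeal (k , g) = Span-isIdeal k g

  adjoin : Carrier → Gens → Gens
  adjoin x (k , g) = suc k , x ∷ g

  ⊆-adjoin : ∀ x s → ⟨ s ⟩ ⊆ ⟨ adjoin x s ⟩
  ⊆-adjoin x (k , g) y (a , y≈) = (0# ∷ a) , trans y≈ (sym (trans (+-congʳ (zeroˡ x)) (+-identityˡ _)))

  adjoin-∋ : ∀ x s → ⟨ adjoin x s ⟩ x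
  adjoin-∋ x (k , g) = Span-∋ (suc k) (x ∷ g) zero

  adjoin-split : ∀ {x y} s → ⟨ adjoin x s ⟩ y →
                 Σ Carrier λ r → Σ Carrier λ p → ⟨ s ⟩ p × (y ≈ r * x + p)
  adjoin-split (k , g) (a , y≈) = a zero , _ , (a ∘ suc , refl) , y≈

  adjoin-product : ∀ {x y m m′} s → ⟨ s ⟩ (x * y) →
                   ⟨ adjoin x s ⟩ m → ⟨ adjoin y s ⟩ m′ → ⟨ s ⟩ (m * m′)
  adjoin-product s xy∈ m∈ m′∈ =
    let r  , p  , p∈  , m≈  = adjoin-split s m∈
        r′ , p′ , p′∈ , m′≈ = adjoin-split s m′∈
    in resp (sym (trans (*-cong m≈ m′≈) (expand r _ p r′ _ p′)))
            (+∈ (*∈ _ xy∈) (+∈ (*∈ _ p∈) (*∈ _ p′∈)))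
    where
    open IsIdeal (⟨⟩-isIdeal s)
    expand : ∀ r x p r′ y p′ →
             (r * x + p) * (r′ * y + p′) ≈ (r * r′) * (x * y) + ((r′ * y + p′) * p + (r * x) * p′)
    expand = solve 6 (λ r x p r′ y p′ → (r :* x :+ p) :* (r′ :* y :+ p′)
                                        := (r :* r′) :* (x :* y) :+ ((r′ :* y :+ p′) :* p :+ (r :* x) :* p′)) refl

  -- Noetherian rings

  -- Read constructively, Noetherianity decides every proposition Q: a finite generating set of
  -- the ideal {x | x ≈ 0 or Q} either contains a proof of Q or consists of zeros, refuting Q.
  excluded-middle : IsNoetherian → ¬ (1# ≈ 0#) → ExcludedMiddle (c ⊔ ℓ)
  excluded-middle noetherian 1≉0 {Q} =
    let k , g , g∈ , ⊆Span = noetherian ZeroOrQ ZeroOrQ-isIdeal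
    in decide k g∈ λ g≈0 q → 1≉0 (let _ , 1≈ = ⊆Span 1# (inj₂ q) in
                                  trans 1≈ (sumFin-zero k (λ i → trans (*-congˡ (g≈0 i)) (zeroʳ _))))
    where
    ZeroOrQ : Pred
    ZeroOrQ x = (x ≈ 0#) ⊎ Q
    ZeroOrQ-isIdeal : IsIdeal ZeroOrQ
    ZeroOrQ-isIdeal = record
      { resp  = λ { x≈y (inj₁ x≈0) → inj₁ (trans (sym x≈y) x≈0) ; _ (inj₂ q) → inj₂ q }
      ; zero∈ = inj₁ refl
      ; +∈    = λ { (inj₁ x≈0) (inj₁ y≈0) → inj₁ (trans (+-cong x≈0 y≈0) (+-identityʳ 0#))
                  ; (inj₂ q) _ → inj₂ q ; _ (inj₂ q) → inj₂ q }
      ; *∈    = λ { r (inj₁ x≈0) → inj₁ (trans (*-congˡ x≈0) (zeroʳ r)) ; _ (inj₂ q) → inj₂ q }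
      }
    decide : ∀ k {g : Fin k → Carrier} → (∀ i → ZeroOrQ (g i)) → ((∀ i → g i ≈ 0#) → ¬ Q) → Dec Q
    decide zero    g∈ ¬Q = no (¬Q λ ())
    decide (suc k) g∈ ¬Q with g∈ zero
    ... | inj₂ q    = yes q
    ... | inj₁ g₀≈0 = decide k (g∈ ∘ suc) λ g≈0 → ¬Q λ { zero → g₀≈0 ; (suc i) → g≈0 i }

  module _ (noetherian : IsNoetherian) (J : ℕ → Pred) (J-ideal : ∀ i → IsIdeal (J i))
           (J-ascending : ∀ i → J i ⊆ J (suc i)) where

    ascending-⊆ : ∀ {i j} → i ≤′ j → J i ⊆ J j
    ascending-⊆ ≤′-refl        = λ _ x∈ → x∈
    ascending-⊆ (≤′-step i≤j) = λ x x∈ → J-ascending _ x (ascending-⊆ i≤j x x∈)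

    ⋃J : Pred
    ⋃J x = ∃ λ i → J i x

    ⋃J-isIdeal : IsIdeal ⋃J
    ⋃J-isIdeal = record
      { resp  = λ x≈y (i , x∈) → i , IsIdeal.resp (J-ideal i) x≈y x∈
      ; zero∈ = 0 , IsIdeal.zero∈ (J-ideal 0)
      ; +∈    = λ {x} {y} (i , x∈) (j , y∈) → i ⊔ℕ j , IsIdeal.+∈ (J-ideal (i ⊔ℕ j))
                  (ascending-⊆ (≤⇒≤′ (m≤m⊔n i j)) x x∈)
                  (ascending-⊆ (≤⇒≤′ (m≤n⊔m i j)) y y∈)
      ; *∈    = λ r (i , x∈) → i , IsIdeal.*∈ (J-ideal i) r x∈
      }

    common-stage : ∀ k (g : Fin k → Carrier) → (∀ i → ⋃J (g i)) → ∃ λ N → ∀ i → J N (g i)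
    common-stage zero    g g∈ = 0 , λ ()
    common-stage (suc k) g g∈ =
      let i , g₀∈ = g∈ zero
          N , g∈N = common-stage k (g ∘ suc) (g∈ ∘ suc)
      in i ⊔ℕ N , λ { zero    → ascending-⊆ (≤⇒≤′ (m≤m⊔n i N)) _ g₀∈
                    ; (suc j) → ascending-⊆ (≤⇒≤′ (m≤n⊔m i N)) _ (g∈N j) }

    ascending-stabilises : ∃ λ N → J (suc N) ⊆ J N
    ascending-stabilises =
      let k , g , g∈ , ⋃J⊆ = noetherian ⋃J ⋃J-isIdeal
          N , g∈N = common-stage k g g∈
      in N , λ x x∈ → Span-least (J-ideal N) k g∈N x (⋃J⊆ x (suc N , x∈))

  Avoids : Pred → Pred → Set (c ⊔ ℓ)
  Avoids J M = ∀ x → J x → ¬ M x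

  record IsMultiplicative (M : Pred) : Set (c ⊔ ℓ) where
    field
      1∈ : M 1#
      *∈ : ∀ {x y} → M x → M y → M (x * y)

  -- Adjoin elements to a finitely generated ideal as long as it stays disjoint from M. The chain
  -- of ideals so obtained stabilises, and an ideal that cannot be enlarged in this way is prime.
  module PrimeAvoidance (lem : ExcludedMiddle (c ⊔ ℓ)) (noetherian : IsNoetherian)
                        {M : Pred} (M-multiplicative : IsMultiplicative M) where
    open IsMultiplicative M-multiplicative

    Extendable : Gens → Set (c ⊔ ℓ)
    Extendable s = Σ Carrier λ x → ¬ ⟨ s ⟩ x × Avoids ⟨ adjoin x s ⟩ M

    Saturated : Gens → Set (c ⊔ ℓ)
    Saturated s = ∀ x → ¬ ⟨ s ⟩ x → ¬ Avoids ⟨ adjoin x s ⟩ M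

    extend : (s : Gens) → Dec (Extendable s) → Gens
    extend s (yes (x , _)) = adjoin x s
    extend s (no _)        = s

    ⊆-extend : ∀ s d → ⟨ s ⟩ ⊆ ⟨ extend s d ⟩
    ⊆-extend s (yes (x , _)) = ⊆-adjoin x s
    ⊆-extend s (no _)        = λ _ y∈ → y∈

    extend-avoids : ∀ s d → Avoids ⟨ s ⟩ M → Avoids ⟨ extend s d ⟩ M
    extend-avoids s (yes (_ , _ , avoids)) _      = avoids
    extend-avoids s (no _)                 avoids = avoids

    extend-stalls⇒saturated : ∀ s d → ⟨ extend s d ⟩ ⊆ ⟨ s ⟩ → Saturated s
    extend-stalls⇒saturated s (yes (x , x∉ , _)) stalls _ _ _        = x∉ (stalls x (adjoin-∋ x s))
    extend-stalls⇒saturated s (no ¬extendable)   _      x x∉ avoids = ¬extendable (x , x∉ , avoids)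

    chain : Gens → ℕ → Gens
    chain s zero    = s
    chain s (suc i) = extend (chain s i) lem

    chain-⊇ : ∀ s i → ⟨ s ⟩ ⊆ ⟨ chain s i ⟩
    chain-⊇ s zero    = λ _ y∈ → y∈
    chain-⊇ s (suc i) = λ y y∈ → ⊆-extend (chain s i) lem y (chain-⊇ s i y y∈)

    chain-avoids : ∀ s → Avoids ⟨ s ⟩ M → ∀ i → Avoids ⟨ chain s i ⟩ M
    chain-avoids s avoids zero    = avoids
    chain-avoids s avoids (suc i) = extend-avoids (chain s i) lem (chain-avoids s avoids i)

    saturated⇒prime : ∀ s → Avoids ⟨ s ⟩ M → Saturated s → IsPrimeIdeal ⟨ s ⟩
    saturated⇒prime s avoids saturated = record
      { ideal  = ⟨⟩-isIdeal s
      ; proper = λ 1∈s → avoids 1# 1∈s 1∈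
      ; prime  = prime
      }
      where
      prime : ∀ x y → ⟨ s ⟩ (x * y) → ⟨ s ⟩ x ⊎ ⟨ s ⟩ y
      prime x y xy∈ with lem {⟨ s ⟩ x} | lem {⟨ s ⟩ y}
      ... | yes x∈ | _      = inj₁ x∈
      ... | no _   | yes y∈ = inj₂ y∈
      ... | no x∉  | no y∉  = contradiction
        (λ m m∈ Mm → saturated y y∉ λ m′ m′∈ Mm′ →
           avoids _ (adjoin-product s xy∈ m∈ m′∈) (*∈ Mm Mm′))
        (saturated x x∉)

    prime-avoiding : ∀ s → Avoids ⟨ s ⟩ M →
                     Σ Gens λ t → IsPrimeIdeal ⟨ t ⟩ × ⟨ s ⟩ ⊆ ⟨ t ⟩ × Avoids ⟨ t ⟩ M
    prime-avoiding s avoids =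
      let N , stalls = ascending-stabilises noetherian (⟨_⟩ ∘ chain s) (⟨⟩-isIdeal ∘ chain s)
                                            (λ i → ⊆-extend (chain s i) lem)
          t = chain s N
      in t , saturated⇒prime t (chain-avoids s avoids N) (extend-stalls⇒saturated t lem stalls) ,
         chain-⊇ s N , chain-avoids s avoids N

  One : Pred
  One y = Lift c (y ≈ 1#)

  one-isMultiplicative : IsMultiplicative One
  one-isMultiplicative = record
    { 1∈ = lift refl
    ; *∈ = λ (lift x≈1) (lift y≈1) → lift (trans (*-cong x≈1 y≈1) (*-identityˡ 1#))
    }

  module Noetherian (noetherian : IsNoetherian) (1≉0 : ¬ (1# ≈ 0#)) where
    lem : ExcludedMiddle (c ⊔ ℓ)
    lem = excluded-middle noetherian 1≉0

    proper⇒⊆prime : ∀ s → ¬ ⟨ s ⟩ 1# → Σ Gens λ t → IsPrimeIdeal ⟨ t ⟩ × ⟨ s ⟩ ⊆ ⟨ t ⟩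
    proper⇒⊆prime s 1∉s =
      let t , t-prime , s⊆t , _ = prime-avoiding s λ y y∈s (lift y≈1) →
                                    1∉s (IsIdeal.resp (⟨⟩-isIdeal s) y≈1 y∈s)
      in t , t-prime , s⊆t
      where
      open PrimeAvoidance lem noetherian one-isMultiplicative

    comaximal-or-commonPrime : ∀ x y → (Σ Carrier λ r → Σ Carrier λ t → r * x + t * y ≈ 1#) ⊎
                                       (Σ Gens λ P → IsPrimeIdeal ⟨ P ⟩ × ⟨ P ⟩ x × ⟨ P ⟩ y)
    comaximal-or-commonPrime x y with lem {Σ Carrier λ r → Σ Carrier λ t → r * x + t * y ≈ 1#}
    ... | yes comaximal = inj₁ comaximal
    ... | no ¬comaximal =
      let P , P-prime , P⊇ = proper⇒⊆prime (2 , x ∷ y ∷ []) proper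
      in inj₂ (P , P-prime , P⊇ x (Span-∋ 2 (x ∷ y ∷ []) zero) , P⊇ y (Span-∋ 2 (x ∷ y ∷ []) (suc zero)))
      where
      proper : ¬ Span 2 (x ∷ y ∷ []) 1#
      proper (r , 1≈) = ¬comaximal (r zero , r (suc zero) , sym (trans 1≈ (+-congˡ (+-identityʳ _))))

  -- Stable range one modulo a nonzero element

  pow≈^ : ∀ x n → pow x n ≈ x ^ n
  pow≈^ x zero    = refl
  pow≈^ x (suc n) = *-congˡ (pow≈^ x n)

  pow-+ : ∀ x m n → pow x (m ℕ.+ n) ≈ pow x m * pow x n
  pow-+ x m n = trans (pow≈^ x (m ℕ.+ n)) (trans (^-homo-* x m n) (sym (*-cong (pow≈^ x m) (pow≈^ x n))))

  PowerTimesOneMod : Carrier → Pred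
  PowerTimesOneMod a y = Σ ℕ λ n → Σ Carrier λ u → Σ Carrier λ b → (1# ≈ u + a * b) × (y ≈ pow a n * u)

  powerTimesOneMod-isMultiplicative : ∀ a → IsMultiplicative (PowerTimesOneMod a)
  powerTimesOneMod-isMultiplicative a = record
    { 1∈ = 0 , 1# , 0# , sym (trans (+-congˡ (zeroʳ a)) (+-identityʳ 1#)) , sym (*-identityˡ 1#)
    ; *∈ = λ (n , u , b , 1≈u+ab , y≈) (n′ , u′ , b′ , 1≈u′+ab′ , y′≈) →
             n ℕ.+ n′ , u * u′ , b * u′ + b′ , product-≡1 1≈u+ab 1≈u′+ab′ ,
             trans (*-cong y≈ y′≈) (trans (swap-middle _ u _ u′) (*-congʳ (sym (pow-+ a n n′))))
    }
    where
    swap-middle : ∀ x y z w → (x * y) * (z * w) ≈ (x * z) * (y * w)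
    swap-middle = solve 4 (λ x y z w → (x :* y) :* (z :* w) := (x :* z) :* (y :* w)) refl
    product-≡1 : ∀ {u b u′ b′} → 1# ≈ u + a * b → 1# ≈ u′ + a * b′ →
                 1# ≈ u * u′ + a * (b * u′ + b′)
    product-≡1 {u} {b} {u′} {b′} 1≈u+ab 1≈u′+ab′ = begin
      1#                         ≈⟨ 1≈u′+ab′ ⟩
      u′ + a * b′                ≈⟨ +-congʳ (*-identityˡ u′) ⟨
      1# * u′ + a * b′           ≈⟨ +-congʳ (*-congʳ 1≈u+ab) ⟩
      (u + a * b) * u′ + a * b′  ≈⟨ solve 5 (λ u u′ a b b′ → (u :+ a :* b) :* u′ :+ a :* b′
                                                            := u :* u′ :+ a :* (b :* u′ :+ b′))
                                             refl u u′ a b b′ ⟩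
      u * u′ + a * (b * u′ + b′) ∎

  module OneDimensional (noetherian : IsNoetherian) (1≉0 : ¬ (1# ≈ 0#)) (dim≤1 : DimAtMostOne) where
    open Noetherian noetherian 1≉0

    -- P is maximal as A ≠ 0, so P + (a) is either P, giving a ∈ P, or everything, giving
    -- 1 - r a ∈ P; both a and 1 - r a lie in PowerTimesOneMod a.
    prime∋nonzero-meets-powerTimesOneMod : ∀ {A} → ¬ (A ≈ 0#) → ∀ a P → IsPrimeIdeal ⟨ P ⟩ →
                                           ⟨ P ⟩ A → ¬ Avoids ⟨ P ⟩ (PowerTimesOneMod a)
    prime∋nonzero-meets-powerTimesOneMod {A} A≉0 a P P-prime A∈P P-avoids
      with dim≤1 ⟨ P ⟩ P-prime (A , A∈P , A≉0) ⟨ adjoin a P ⟩ (⟨⟩-isIdeal (adjoin a P)) (⊆-adjoin a P)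
    ... | inj₁ P+a⊆P = P-avoids a (P+a⊆P a (adjoin-∋ a P)) a∈M
      where
      a∈M : PowerTimesOneMod a a
      a∈M = 1 , 1# , 0# , sym (trans (+-congˡ (zeroʳ a)) (+-identityʳ 1#)) ,
            sym (trans (*-identityʳ _) (*-identityʳ a))
    ... | inj₂ 1∈P+a =
      let r , p , p∈P , 1≈ra+p = adjoin-split P 1∈P+a
      in P-avoids p p∈P (0 , p , r , trans 1≈ra+p (trans (+-comm _ _) (+-congˡ (*-comm r a))) ,
                         sym (*-identityˡ p))

    principal-meets-powerTimesOneMod : ∀ {A} → ¬ (A ≈ 0#) → ∀ a →
                                       ∃ λ y → Span 1 (A ∷ []) y × PowerTimesOneMod a y
    principal-meets-powerTimesOneMod {A} A≉0 a
      with lem {∃ λ y → Span 1 (A ∷ []) y × PowerTimesOneMod a y}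
    ... | yes meets   = meets
    ... | no disjoint =
      let P , P-prime , ⟨A⟩⊆P , P-avoids =
            prime-avoiding (1 , A ∷ []) λ y y∈ y∈M → disjoint (y , y∈ , y∈M)
      in ⊥-elim (prime∋nonzero-meets-powerTimesOneMod A≉0 a P P-prime
                   (⟨A⟩⊆P A (Span-∋ 1 (A ∷ []) zero)) P-avoids)
      where open PrimeAvoidance lem noetherian (powerTimesOneMod-isMultiplicative a)

    -- For c = 1 - (ab)ⁿ⁺¹: if a ∈ P then c ≡ 1 and h ≡ 1 modulo P, so c h ∉ P; otherwise u ∈ P,
    -- i.e. a b ≡ 1, hence c ∈ P and a ≡ a + c h ≡ 0 modulo P.
    prime∋aⁿu⇒∌a+ch : ∀ {P a h s u b} → IsPrimeIdeal P → 1# ≈ s * a + h → 1# ≈ u + a * b →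
                      ∀ n → P (pow a n * u) → ¬ P (a + (1# - pow (a * b) (suc n)) * h)
    prime∋aⁿu⇒∌a+ch {P} {a} {h} {s} {u} {b} P-prime 1≈sa+h 1≈u+ab n aⁿu∈P a+ch∈P with lem {P a}
    ... | yes a∈P = [ (λ c∈P → proper (resp (//-rightDividesˡ _ 1#) (+∈ c∈P (ideal-pow ideal n ab∈P))))
                    , (λ h∈P → proper (resp (sym 1≈sa+h) (+∈ (*∈ s a∈P) h∈P))) ]′
                    (prime _ h (resp (xyx⁻¹≈y a _) (+∈ a+ch∈P (ideal-neg ideal a∈P))))
      where
      open IsPrimeIdeal P-prime
      open IsIdeal ideal
      ab∈P : P (a * b)
      ab∈P = resp (*-comm b a) (*∈ b a∈P)
    ... | no a∉P = a∉P (resp (//-rightDividesʳ _ a) (+∈ a+ch∈P (ideal-neg ideal ch∈P)))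
      where
      open IsPrimeIdeal P-prime
      open IsIdeal ideal
      u∈P : P u
      u∈P = [ (λ aⁿ∈P → contradiction (prime-pow P-prime n aⁿ∈P) a∉P) , id ]′ (prime _ _ aⁿu∈P)
      1-ab∈P : P (1# - a * b)
      1-ab∈P = resp (sym (trans (+-congʳ 1≈u+ab) (//-rightDividesʳ (a * b) u))) u∈P
      ch∈P : P ((1# - pow (a * b) (suc n)) * h)
      ch∈P = resp (*-comm _ _) (*∈ h (ideal-1-pow ideal 1-ab∈P (suc n)))

    stable-range : ∀ {A a h s} → ¬ (A ≈ 0#) → 1# ≈ s * a + h →
                   Σ Carrier λ c → Σ Carrier λ r → Σ Carrier λ t → r * A + t * (a + c * h) ≈ 1#
    stable-range {A} {a} {h} A≉0 1≈sa+h =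
      let y , y∈⟨A⟩ , n , u , b , 1≈u+ab , y≈aⁿu = principal-meets-powerTimesOneMod A≉0 a
          c = 1# - pow (a * b) (suc n)
      in c , [ id , (λ (P , P-prime , A∈P , a+ch∈P) → contradiction a+ch∈P
                 (prime∋aⁿu⇒∌a+ch P-prime 1≈sa+h 1≈u+ab n (IsIdeal.resp (⟨⟩-isIdeal P) y≈aⁿu
                   (Span-least (⟨⟩-isIdeal P) 1 {A ∷ []} (λ { zero → A∈P }) y y∈⟨A⟩)))) ]′
             (comaximal-or-commonPrime A (a + c * h))

  -- Bases of Oⁿ and elementary transvections

  lincomb-cong : ∀ {n} k {a a′ : Vecᴼ k} (b : Fin k → Vecᴼ n) → a ≈ᵛ a′ →
                 lincomb k a b ≈ᵛ lincomb k a′ b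
  lincomb-cong k b a≈a′ j = sumFin-cong k (λ i → *-congʳ (a≈a′ i))

  lincomb-+ : ∀ {n} k (a a′ : Vecᴼ k) (b : Fin k → Vecᴼ n) →
              lincomb k (a +ᵛ a′) b ≈ᵛ (lincomb k a b +ᵛ lincomb k a′ b)
  lincomb-+ k a a′ b j = trans (sumFin-cong k (λ i → distribʳ (b i j) (a i) (a′ i))) (sumFin-+ k _ _)

  lincomb-· : ∀ {n} k r (a : Vecᴼ k) (b : Fin k → Vecᴼ n) →
              lincomb k (r ·ᵛ a) b ≈ᵛ (r ·ᵛ lincomb k a b)
  lincomb-· k r a b j = trans (sumFin-cong k (λ i → *-assoc r (a i) (b i j))) (sym (*-distribˡ-sumFin k r _))

  lincomb-δ : ∀ {n} k (i : Fin k) (b : Fin k → Vecᴼ n) → lincomb k (δ i) b ≈ᵛ b i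
  lincomb-δ k i b j = sumFin-δ k i (λ l → b l j)

  module _ {n} {L : Vecᴼ n → Carrier} (L-linear : IsLinearSurjection L) where
    open IsLinearSurjection L-linear

    L-0 : L (λ _ → 0#) ≈ 0#
    L-0 = trans (resp (λ _ → sym (zeroˡ 0#))) (trans (homogen 0# _) (zeroˡ _))

    L-lincomb : ∀ k (a : Vecᴼ k) (b : Fin k → Vecᴼ n) → L (lincomb k a b) ≈ sumFin k (λ i → a i * L (b i))
    L-lincomb zero    a b = L-0
    L-lincomb (suc k) a b = trans (additive _ _) (+-cong (homogen _ _) (L-lincomb k (a ∘ suc) (b ∘ suc)))

    ∈ᶠ⇒Iτ : ∀ {k} {s : Fin k → Vecᴼ n} {u} → u ∈ᶠ s → Iτ L s (L u)
    ∈ᶠ⇒Iτ {k} {s} (i , u≈sᵢ) =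
      IsIdeal.resp (Span-isIdeal k (L ∘ s)) (resp (≋-sym u≈sᵢ)) (Span-∋ k (L ∘ s) i)

  SpannedWithout : ∀ {n} → (Fin n → Vecᴼ n) → Fin n → Vecᴼ n → Set (c ⊔ ℓ)
  SpannedWithout {n} b k x = Σ (Vecᴼ n) λ d → d k ≈ 0# × x ≈ᵛ lincomb n d b

  module _ {n} {b : Fin n → Vecᴼ n} {k : Fin n} where

    spannedWithout-resp : ∀ {x y} → x ≈ᵛ y → SpannedWithout b k x → SpannedWithout b k y
    spannedWithout-resp x≈y (d , dₖ≈0 , x≈) = d , dₖ≈0 , ≋-trans (≋-sym x≈y) x≈

    spannedWithout-+ᵛ : ∀ {x y} → SpannedWithout b k x → SpannedWithout b k y → SpannedWithout b k (x +ᵛ y)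
    spannedWithout-+ᵛ (d , dₖ≈0 , x≈) (e , eₖ≈0 , y≈) =
      d +ᵛ e , trans (+-cong dₖ≈0 eₖ≈0) (+-identityʳ 0#) ,
      λ j → trans (+-cong (x≈ j) (y≈ j)) (sym (lincomb-+ n d e b j))

    spannedWithout-·ᵛ : ∀ r {x} → SpannedWithout b k x → SpannedWithout b k (r ·ᵛ x)
    spannedWithout-·ᵛ r (d , dₖ≈0 , x≈) =
      r ·ᵛ d , trans (*-congˡ dₖ≈0) (zeroʳ r) , λ j → trans (*-congˡ (x≈ j)) (sym (lincomb-· n r d b j))

    spannedWithout-basis : ∀ {j} → j ≢ k → SpannedWithout b k (b j)
    spannedWithout-basis {j} j≢k = δ j , δ-offdiag j≢k , ≋-sym (lincomb-δ n j b)

    L-spannedWithout : ∀ {L : Vecᴼ n → Carrier} → IsLinearSurjection L → ∀ {J} → IsIdeal J →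
                       (∀ j → j ≢ k → J (L (b j))) → ∀ {x} → SpannedWithout b k x → J (L x)
    L-spannedWithout {L} L-linear {J} J-ideal Lb∈J (d , dₖ≈0 , x≈) =
      resp (sym (trans (IsLinearSurjection.resp L-linear x≈) (L-lincomb L-linear n d b)))
           (ideal-sumFin J-ideal n term∈J)
      where
      open IsIdeal J-ideal
      term∈J : ∀ i → J (d i * L (b i))
      term∈J i with i ≟ k
      ... | yes ≡.refl = resp (sym (trans (*-congʳ dₖ≈0) (zeroˡ _))) zero∈
      ... | no  i≢k    = *∈ (d i) (Lb∈J i i≢k)

    basis-decompose : IsBasis b → ∀ z →
                      Σ Carrier λ r → Σ (Vecᴼ n) λ y → SpannedWithout b k y × z ≈ᵛ ((r ·ᵛ b k) +ᵛ y)
    basis-decompose b-basis z =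
      let α , z≈ = IsBasis.spans b-basis z
          d = α +ᵛ ((- α k) ·ᵛ δ k)
      in α k , lincomb n d b ,
         (d , trans (+-congˡ (trans (*-congˡ (δ-diag k)) (*-identityʳ _))) (-‿inverseʳ (α k)) , ≋-refl) ,
         λ j → trans (z≈ j) (cancel (trans (lincomb-+ n α _ b j)
                 (+-congˡ (trans (lincomb-· n (- α k) (δ k) b j) (*-congˡ (lincomb-δ n k b j))))))
      where
      cancel : ∀ {r x s t} → t ≈ s + (- r) * x → s ≈ r * x + t
      cancel {r} {x} {s} {t} t≈ = sym (begin
        r * x + t              ≈⟨ +-congˡ t≈ ⟩
        r * x + (s + - r * x)  ≈⟨ solve 4 (λ r x s r′ → r :* x :+ (s :+ r′ :* x) := s :+ (r :+ r′) :* x)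
                                          refl r x s (- r) ⟩
        s + (r - r) * x        ≈⟨ +-congˡ (trans (*-congʳ (-‿inverseʳ r)) (zeroˡ x)) ⟩
        s + 0#                 ≈⟨ +-identityʳ s ⟩
        s                      ∎)

  unimodular-decomposition : ∀ {n} {L : Vecᴼ n → Carrier} → IsLinearSurjection L →
                             ∀ {b} → IsBasis b → ∀ k →
                             Σ Carrier λ r → Σ (Vecᴼ n) λ y → SpannedWithout b k y × (1# ≈ r * L (b k) + L y)
  unimodular-decomposition {L = L} L-linear {b} b-basis k =
    let z , Lz≈1 = surjective 1#
        r , y , y∈ , z≈ = basis-decompose b-basis z
    in r , y , y∈ , (begin
      1#                  ≈⟨ Lz≈1 ⟨
      L z                 ≈⟨ resp z≈ ⟩
      L ((r ·ᵛ b k) +ᵛ y) ≈⟨ additive _ y ⟩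
      L (r ·ᵛ b k) + L y  ≈⟨ +-congʳ (homogen r (b k)) ⟩
      r * L (b k) + L y   ∎)
    where open IsLinearSurjection L-linear

  transvect : ∀ {n} → (Fin n → Vecᴼ n) → Fin n → Vecᴼ n → Fin n → Vecᴼ n
  transvect b k x i = b i +ᵛ (δ k i ·ᵛ x)

  module _ {n} {b : Fin n → Vecᴼ n} {k : Fin n} {x : Vecᴼ n} where

    transvect-at : transvect b k x k ≈ᵛ (b k +ᵛ x)
    transvect-at j = +-congˡ (trans (*-congʳ (δ-diag k)) (*-identityˡ _))

    transvect-away : ∀ {i} → i ≢ k → transvect b k x i ≈ᵛ b i
    transvect-away i≢k j = trans (+-congˡ (trans (*-congʳ (δ-offdiag (i≢k ∘ ≡.sym))) (zeroˡ _))) (+-identityʳ _)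

    lincomb-transvect : ∀ {d} → x ≈ᵛ lincomb n d b → ∀ a →
                        lincomb n a (transvect b k x) ≈ᵛ lincomb n (a +ᵛ (a k ·ᵛ d)) b
    lincomb-transvect {d} x≈ a j = begin
      sumFin n (λ i → a i * (b i j + δ k i * x j))
        ≈⟨ sumFin-cong n (λ i → solve 4 (λ a b δ x → a :* (b :+ δ :* x) := a :* b :+ x :* (δ :* a))
                                        refl (a i) (b i j) (δ k i) (x j)) ⟩
      sumFin n (λ i → a i * b i j + x j * (δ k i * a i))
        ≈⟨ sumFin-+ n _ _ ⟩
      lincomb n a b j + sumFin n (λ i → x j * (δ k i * a i))
        ≈⟨ +-congˡ (sym (*-distribˡ-sumFin n (x j) _)) ⟩
      lincomb n a b j + x j * sumFin n (λ i → δ k i * a i)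
        ≈⟨ +-congˡ (trans (*-cong (x≈ j) (sumFin-δ n k a)) (*-comm _ _)) ⟩
      lincomb n a b j + a k * lincomb n d b j
        ≈⟨ sym (trans (lincomb-+ n a _ b j) (+-congˡ (lincomb-· n (a k) d b j))) ⟩
      lincomb n (a +ᵛ (a k ·ᵛ d)) b j ∎

    transvect-isBasis : IsBasis b → SpannedWithout b k x → IsBasis (transvect b k x)
    transvect-isBasis b-basis (d , dₖ≈0 , x≈) = record { spans = spans′ ; independent = independent′ }
      where
      open IsBasis b-basis
      absorb : ∀ {y z} → z ≈ 0# → y + z ≈ y
      absorb z≈0 = trans (+-congˡ z≈0) (+-identityʳ _)
      independent′ : ∀ a → lincomb n a (transvect b k x) ≈ᵛ (λ _ → 0#) → ∀ i → a i ≈ 0#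
      independent′ a lincomb≈0 i = trans (sym (absorb (trans (*-congʳ aₖ≈0) (zeroˡ _)))) (coefficient≈0 i)
        where
        coefficient≈0 : ∀ i → a i + a k * d i ≈ 0#
        coefficient≈0 = independent _ (≋-trans (≋-sym (lincomb-transvect x≈ a)) lincomb≈0)
        aₖ≈0 : a k ≈ 0#
        aₖ≈0 = trans (sym (absorb (trans (*-congˡ dₖ≈0) (zeroʳ _)))) (coefficient≈0 k)
      spans′ : ∀ y → Σ (Vecᴼ n) λ β → y ≈ᵛ lincomb n β (transvect b k x)
      spans′ y =
        let α , y≈ = spans y
            β = λ i → α i - α k * d i
            βₖ≈αₖ = absorb (trans (-‿cong (trans (*-congˡ dₖ≈0) (zeroʳ _))) ε⁻¹≈ε)
        in β , ≋-trans y≈ (≋-trans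
                 (lincomb-cong n b (λ i → sym (trans (+-congˡ (*-congʳ βₖ≈αₖ)) (//-rightDividesˡ _ (α i)))))
                 (≋-sym (lincomb-transvect x≈ β)))

  basis-injective : ∀ {n} {b : Fin n → Vecᴼ n} → ¬ (1# ≈ 0#) → IsBasis b →
                    ∀ {i j} → b i ≈ᵛ b j → i ≡ j
  basis-injective {n} {b} 1≉0 b-basis {i} {j} bᵢ≈bⱼ with i ≟ j
  ... | yes i≡j = i≡j
  ... | no  i≢j = contradiction (trans (sym aᵢ≈1) (IsBasis.independent b-basis a lincomb≈0 i)) 1≉0
    where
    a : Vecᴼ n
    a = δ i +ᵛ ((- 1#) ·ᵛ δ j)
    aᵢ≈1 : a i ≈ 1#
    aᵢ≈1 = trans (+-cong (δ-diag i) (trans (*-congˡ (δ-offdiag (i≢j ∘ ≡.sym))) (zeroʳ _))) (+-identityʳ 1#)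
    lincomb≈0 : lincomb n a b ≈ᵛ (λ _ → 0#)
    lincomb≈0 l = begin
      lincomb n a b l
        ≈⟨ trans (lincomb-+ n _ _ b l) (+-congˡ (lincomb-· n _ _ b l)) ⟩
      lincomb n (δ i) b l + - 1# * lincomb n (δ j) b l
        ≈⟨ +-cong (lincomb-δ n i b l)
                  (trans (-1*x≈-x _) (-‿cong (trans (lincomb-δ n j b l) (sym (bᵢ≈bⱼ l))))) ⟩
      b i l - b i l
        ≈⟨ -‿inverseʳ _ ⟩
      0# ∎

  missing-basis-index : ∀ {m} {σ : Fin m → Vecᴼ (suc m)} {b : Fin (suc m) → Vecᴼ (suc m)} →
                        Distinct σ → (σ∈b : ∀ i → σ i ∈ᶠ b) →
                        Σ (Fin (suc m)) λ k →
                          (∀ i → proj₁ (σ∈b i) ≢ k) × (∀ j → j ≢ k → b j ∈ᶠ σ)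
  missing-basis-index {m} {σ} {b} σ-distinct σ∈b =
    let k , f≢k = injective⇒misses f f-injective
    in k , f≢k , λ j j≢k → let i , fᵢ≡j = injective-missing⇒hits f f-injective f≢k j j≢k
                           in i , ≋-trans (≋-reflexive (≡.cong b (≡.sym fᵢ≡j))) (≋-sym (proj₂ (σ∈b i)))
    where
    f : Fin m → Fin (suc m)
    f = proj₁ ∘ σ∈b
    f-injective : Injective _≡_ _≡_ f
    f-injective {i} {j} fᵢ≡fⱼ = σ-distinct i j
      (≋-trans (proj₂ (σ∈b i)) (≋-trans (≋-reflexive (≡.cong b fᵢ≡fⱼ)) (≋-sym (proj₂ (σ∈b j)))))

  -- Vertices of the link

  ZeroOrOneMod : Pred → Carrier → Set (c ⊔ ℓ)
  ZeroOrOneMod I p = (p ≡ 0# mod I) ⊎ (p ≡ 1# mod I)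

  module _ {I : Pred} (I-ideal : IsIdeal I) where
    open IsIdeal I-ideal

    ≡-mod-resp : ∀ {p q e} → p ≈ q → p ≡ e mod I → q ≡ e mod I
    ≡-mod-resp p≈q = resp (+-congʳ p≈q)

    ≡-mod-+ : ∀ {p q e} → p ≡ e mod I → I q → (p + q) ≡ e mod I
    ≡-mod-+ {p} {q} {e} p≡e q∈I =
      resp (solve 3 (λ p e q → (p :+ e) :+ q := (p :+ q) :+ e) refl p (- e) q) (+∈ p≡e q∈I)

    zeroOrOneMod-resp : ∀ {p q} → p ≈ q → ZeroOrOneMod I p → ZeroOrOneMod I q
    zeroOrOneMod-resp p≈q = Sum.map (≡-mod-resp p≈q) (≡-mod-resp p≈q)

    zeroOrOneMod-+ : ∀ {p q} → ZeroOrOneMod I p → I q → ZeroOrOneMod I (p + q)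
    zeroOrOneMod-+ p-01 q∈I = Sum.map (λ p≡0 → ≡-mod-+ p≡0 q∈I) (λ p≡1 → ≡-mod-+ p≡1 q∈I) p-01

  comaximal⇒Span-full : ∀ {g : Fin 2 → Carrier} {r t} → r * g zero + t * g (suc zero) ≈ 1# →
                        ∀ x → Span 2 g x
  comaximal⇒Span-full {g} {r} {t} comaximal x = (x * r) ∷ (x * t) ∷ [] , (begin
    x                                            ≈⟨ *-identityʳ x ⟨
    x * 1#                                       ≈⟨ *-congˡ comaximal ⟨
    x * (r * g zero + t * g (suc zero))          ≈⟨ solve 5 (λ x r g₀ t g₁ → x :* (r :* g₀ :+ t :* g₁)
                                                                          := x :* r :* g₀ :+ (x :* t :* g₁ :+ con 0))
                                                           refl x r (g zero) t (g (suc zero)) ⟩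
    x * r * g zero + (x * t * g (suc zero) + 0#) ∎)

  comaximal-shift : ∀ {A W r t} → r * A + t * W ≈ 1# → ∀ μ → (r + t * μ) * A + t * (W + (- μ) * A) ≈ 1#
  comaximal-shift {A} {W} {r} {t} comaximal μ = begin
    (r + t * μ) * A + t * (W + (- μ) * A) ≈⟨ solve 6 (λ r t μ A W ν → (r :+ t :* μ) :* A :+ t :* (W :+ ν :* A)
                                                                     := (r :* A :+ t :* W) :+ t :* A :* (μ :+ ν))
                                                     refl r t μ A W (- μ) ⟩
    (r * A + t * W) + t * A * (μ - μ)     ≈⟨ +-cong comaximal (trans (*-congˡ (-‿inverseʳ μ)) (zeroʳ _)) ⟩
    1# + 0#                               ≈⟨ +-identityʳ 1# ⟩
    1#                                    ∎

  module LinkVertex {n m} {L : Vecᴼ n → Carrier} (L-linear : IsLinearSurjection L)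
                    {I : Pred} (I-ideal : IsIdeal I) (1≉0 : ¬ (1# ≈ 0#))
                    {b : Fin n → Vecᴼ n} (b-IBasis : IsIBasis L I b) {k : Fin n} {σ : Fin m → Vecᴼ n}
                    (σ∈b : ∀ i → σ i ∈ᶠ b) (σ≢k : ∀ i → proj₁ (σ∈b i) ≢ k) where
    open IsLinearSurjection L-linear
    open IsIdeal I-ideal renaming (resp to I-resp)

    transvect-inLink : ∀ {x} → SpannedWithout b k x → ZeroOrOneMod I (L (b k +ᵛ x)) →
                       InLink L I σ (b k +ᵛ x)
    transvect-inLink {x} x∈ Lw-01 = w∉σ , transvect b k x , (b′-basis , b′-01) , w◂σ∈b′
      where
      b′-at : transvect b k x k ≈ᵛ (b k +ᵛ x)
      b′-at = transvect-at {b = b}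
      b′-away : ∀ {i} → i ≢ k → transvect b k x i ≈ᵛ b i
      b′-away = transvect-away {b = b}
      b′-basis : IsBasis (transvect b k x)
      b′-basis = transvect-isBasis (proj₁ b-IBasis) x∈
      σ≈b′ : ∀ i → σ i ≈ᵛ transvect b k x (proj₁ (σ∈b i))
      σ≈b′ i = ≋-trans (proj₂ (σ∈b i)) (≋-sym (b′-away (σ≢k i)))
      b′-01 : ∀ i → ZeroOrOneMod I (L (transvect b k x i))
      b′-01 i with i ≟ k
      ... | yes ≡.refl = zeroOrOneMod-resp I-ideal (resp (≋-sym b′-at)) Lw-01
      ... | no  i≢k    = zeroOrOneMod-resp I-ideal (resp (≋-sym (b′-away i≢k))) (proj₂ b-IBasis i)
      w◂σ∈b′ : ∀ i → ((b k +ᵛ x) ◂ σ) i ∈ᶠ transvect b k x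
      w◂σ∈b′ zero    = k , ≋-sym b′-at
      w◂σ∈b′ (suc i) = proj₁ (σ∈b i) , σ≈b′ i
      w∉σ : ¬ ((b k +ᵛ x) ∈ᶠ σ)
      w∉σ (i , w≈σᵢ) =
        σ≢k i (≡.sym (basis-injective 1≉0 b′-basis (≋-trans b′-at (≋-trans w≈σᵢ (σ≈b′ i)))))

    UnimodularLinkVertex : Vecᴼ n → Set (c ⊔ ℓ)
    UnimodularLinkVertex v = Σ (Vecᴼ n) λ w → InLink L I σ w × (∀ x → Iτ L (pair v w) x)

    module _ {v : Vecᴼ n} (v∈σ : v ∈ᶠ σ) {y : Vecᴼ n} (y∈ : SpannedWithout b k y) {c r t : Carrier}
             (coprime : r * L v + t * (L (b k) + c * L y) ≈ 1#) where

      W : Carrier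
      W = L (b k) + c * L y

      w : Carrier → Vecᴼ n
      w μ = b k +ᵛ ((c ·ᵛ y) +ᵛ ((- μ) ·ᵛ v))

      L-w : ∀ μ → L (w μ) ≈ W + (- μ) * L v
      L-w μ = begin
        L (w μ)                                 ≈⟨ trans (additive _ _) (+-congˡ (additive _ _)) ⟩
        L (b k) + (L (c ·ᵛ y) + L ((- μ) ·ᵛ v)) ≈⟨ +-congˡ (+-cong (homogen c y) (homogen (- μ) v)) ⟩
        L (b k) + (c * L y + (- μ) * L v)       ≈⟨ +-assoc _ _ _ ⟨
        W + (- μ) * L v                         ∎

      vertex : ∀ μ → ZeroOrOneMod I (W + (- μ) * L v) → UnimodularLinkVertex v
      vertex μ W-μLv-01 =
        w μ , transvect-inLink w∈ (zeroOrOneMod-resp I-ideal (sym (L-w μ)) W-μLv-01) ,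
        comaximal⇒Span-full {L ∘ pair v (w μ)} (trans (+-congˡ (*-congˡ (L-w μ))) (comaximal-shift coprime μ))
        where
        v∈ : SpannedWithout b k v
        v∈ = let i , v≈σᵢ = v∈σ in
             spannedWithout-resp (≋-sym (≋-trans v≈σᵢ (proj₂ (σ∈b i)))) (spannedWithout-basis (σ≢k i))
        w∈ : SpannedWithout b k ((c ·ᵛ y) +ᵛ ((- μ) ·ᵛ v))
        w∈ = spannedWithout-+ᵛ (spannedWithout-·ᵛ c y∈) (spannedWithout-·ᵛ (- μ) v∈)

      vertex-if-Ly∈I : I (L y) → UnimodularLinkVertex v
      vertex-if-Ly∈I Ly∈I = vertex 0#
        (zeroOrOneMod-+ I-ideal (zeroOrOneMod-+ I-ideal (proj₂ b-IBasis k) (*∈ c Ly∈I))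
                                (I-resp (sym (trans (*-congʳ ε⁻¹≈ε) (zeroˡ _))) zero∈))

      vertex-if-Lv≡1 : L v ≡ 1# mod I → UnimodularLinkVertex v
      vertex-if-Lv≡1 Lv≡1 = vertex W (inj₁ (I-resp multiple (*∈ (- W) Lv≡1)))
        where
        multiple : (- W) * (L v - 1#) ≈ (W + (- W) * L v) - 0#
        multiple = begin
          (- W) * (L v - 1#)           ≈⟨ distribˡ _ _ _ ⟩
          (- W) * L v + (- W) * (- 1#) ≈⟨ +-congˡ (trans (sym (-‿distribʳ-* _ _))
                                            (trans (-‿cong (*-identityʳ _)) (⁻¹-involutive W))) ⟩
          (- W) * L v + W              ≈⟨ +-comm _ _ ⟩
          W + (- W) * L v              ≈⟨ trans (+-congˡ ε⁻¹≈ε) (+-identityʳ _) ⟨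
          (W + (- W) * L v) - 0#       ∎

lemma2p14 : ∀ {c ℓ : Level} (R : CommutativeRing c ℓ) →
    let open CommutativeRing R
        open Theory R
    in IsDedekindDomain →
       (I : Pred) → IsIdeal I →
       (n : ℕ) → 3 ≤ n →
       (L : Vecᴼ n → Carrier) → IsLinearSurjection L →
       (σ : Fin (n ∸ 1) → Vecᴼ n) → Distinct σ → InSomeIBasis L I σ →
       (v : Vecᴼ n) → v ∈ᶠ σ → ¬ (L v ≈ 0#) →
       (¬ (Iτ L σ ⊆ I) → L v ≡ 1# mod I) →
       Σ (Vecᴼ n) λ w → InLink L I σ w × (∀ x → Iτ L (pair v w) x)
-- n ≥ 3 is used only to rule out n = 0.
lemma2p14 R ded I I-ideal (suc m) _ L L-linear σ σ-distinct (b , b-IBasis , σ∈b) v v∈σ Lv≉0 Iσ⊈I⇒Lv≡1 =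
  let open Theory R
      open Theory.IsDedekindDomain ded
      open CommutativeAlgebra R
      open Noetherian noetherian (proj₁ domain)
      open OneDimensional noetherian (proj₁ domain) dimLeOne
      k , σ≢k , others∈σ = missing-basis-index σ-distinct σ∈b
      _ , y , y∈ , 1≈rLbₖ+Ly = unimodular-decomposition L-linear (proj₁ b-IBasis) k
      Ly∈Iσ = L-spannedWithout L-linear (Span-isIdeal _ _)
                (λ j j≢k → ∈ᶠ⇒Iτ L-linear (others∈σ j j≢k)) y∈
      _ , _ , _ , coprime = stable-range Lv≉0 1≈rLbₖ+Ly
      open LinkVertex L-linear I-ideal (proj₁ domain) b-IBasis σ∈b σ≢k
  in case lem {Iτ L σ ⊆ I} of λ
       { (yes Iσ⊆I) → vertex-if-Ly∈I v∈σ y∈ coprime (Iσ⊆I _ Ly∈Iσ)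
       ; (no Iσ⊈I)  → vertex-if-Lv≡1 v∈σ y∈ coprime (Iσ⊈I⇒Lv≡1 Iσ⊈I) }
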